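{- Let $G=(V\cup\{m\},E)$ and $G'=(V'\cup\{m'\},E')$ be bipartite graphs with disjoint vertex sets. Then for any choice of the vertices $m$ and $m'$, the split recomposition $G\ast G'$ is a comparability graph.
   Context: All graphs are finite, simple and connected. A comparability graph is a graph admitting a transitive orientation (an orientation in which $\overrightarrow{ab},\overrightarrow{bc}$ imply $\overrightarrow{ac}$). Split recomposition: for graphs $G=(V\cup\{m\},E)$ and $G'=(V'\cup\{m'\},E')$ with disjoint vertex sets, $G\ast G'$ has vertex set $V\cup V'$ and edges: those of $G[V]$, those of $G'[V']$, and all $\overline{ab}$ with $a\in N_G(m)$, $b\in N_{G'}(m')$. -}

module Defs where

open import Data.Nat using (ℕ; suc)
open import Data.Fin using (Fin)
open import Data.Bool using (Bool)
open import Data.Sum using (_⊎_; inj₁; inj₂)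
open import Data.Product using (Σ; _×_; ∃; _,_)
open import Data.Empty using (⊥)
open import Relation.Nullary using (¬_)
open import Relation.Binary.PropositionalEquality using (_≡_; _≢_)
open import Data.List using (List; []; _∷_)

record Graph (V : Set) : Set₁ where
  field
    Adj     : V → V → Set
    sym     : ∀ {u v} → Adj u v → Adj v u
    irrefl  : ∀ {v} → ¬ Adj v v
open Graph public

data Walk {V : Set} (G : Graph V) : V → V → Set where
  here : ∀ {v} → Walk G v v
  step : ∀ {u w v} → Adj G u w → Walk G w v → Walk G u v

Connected : {V : Set} → Graph V → Set
Connected G = ∀ u v → Walk G u v

Bipartite : {V : Set} → Graph V → Set
Bipartite {V} G = Σ (V → Bool) λ c → ∀ {u v} → Adj G u v → c u ≢ c v

Comparability : {V : Set} → Graph V → Set₁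
Comparability {V} G =
  Σ (V → V → Set) λ O →
    (∀ {u v} → O u v → Adj G u v) ×
    (∀ {u v} → Adj G u v → O u v ⊎ O v u) ×
    (∀ {u v} → O u v → ¬ O v u) ×
    (∀ {a b c} → O a b → O b c → O a c)

Rest : ∀ {n} → Fin n → Set
Rest {n} m = Σ (Fin n) λ v → v ≢ m

_⟨_⟩∗⟨_⟩_ : ∀ {n n'} → Graph (Fin n) → (m : Fin n) → (m' : Fin n') → Graph (Fin n')
           → Graph (Rest m ⊎ Rest m')
_⟨_⟩∗⟨_⟩_ {n} {n'} G m m' G' = record { Adj = A ; sym = λ {u} {v} → s {u} {v} ; irrefl = λ {v} → i {v} }
  where
  A : Rest m ⊎ Rest m' → Rest m ⊎ Rest m' → Set
  A (inj₁ (a , _)) (inj₁ (b , _)) = Adj G a b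
  A (inj₂ (a , _)) (inj₂ (b , _)) = Adj G' a b
  A (inj₁ (a , _)) (inj₂ (b , _)) = Adj G m a × Adj G' m' b
  A (inj₂ (b , _)) (inj₁ (a , _)) = Adj G m a × Adj G' m' b
  s : ∀ {u v} → A u v → A v u
  s {inj₁ _} {inj₁ _} e = sym G e
  s {inj₂ _} {inj₂ _} e = sym G' e
  s {inj₁ _} {inj₂ _} e = e
  s {inj₂ _} {inj₁ _} e = e
  i : ∀ {v} → ¬ A v v
  i {inj₁ _} = irrefl G
  i {inj₂ _} = irrefl G'

{-# OPTIONS --safe #-}
-- Recolour G so that m is `false` and G' so that m' is `true`. Then every
-- neighbour of m is `true` and every neighbour of m' is `false`, so the two
-- colourings together properly colour G ∗ G', whose new edges all join such
-- neighbours. A bipartite graph is a comparability graph: orient each edge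
-- away from its `true` end; no vertex is both a head and a tail, so
-- transitivity holds vacuously.
module Submission where

open import Defs hiding (sym)
open import Data.Fin using (Fin)
open import Data.Bool using (Bool; true; false; not; _≟_)
open import Data.Bool.Properties using (not-injective; ¬-not)
open import Data.Sum using (_⊎_; inj₁; inj₂; [_,_])
open import Data.Product using (∃-syntax; _×_; _,_; proj₁)
open import Function using (_∘_)
open import Relation.Nullary using (¬_; yes; no; contradiction)
open import Relation.Binary.PropositionalEquality using (_≡_; _≢_; refl; sym; trans; cong)

ProperColouring : {V : Set} → Graph V → (V → Bool) → Set
ProperColouring G c = ∀ {u v} → Adj G u v → c u ≢ c v

module _ {V : Set} {G : Graph V} where

  adjacent-colour : ∀ {c} → ProperColouring G c → ∀ {u v} → Adj G u v → c v ≡ not (c u)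
  adjacent-colour proper e = ¬-not (proper e ∘ sym)

  properColouring-with : Bipartite G → (v : V) (b : Bool) →
                         ∃[ c ] ProperColouring G c × c v ≡ b
  properColouring-with (c , proper) v b with c v ≟ b
  ... | yes cv≡b = c , proper , cv≡b
  ... | no  cv≢b = not ∘ c , (λ e → proper e ∘ not-injective) , sym (¬-not (cv≢b ∘ sym))

  bipartite⇒comparability : Bipartite G → Comparability G
  bipartite⇒comparability (c , proper) = O , proj₁ , orient , asymmetric , transitive
    where
    O : V → V → Set
    O u v = Adj G u v × c u ≡ true

    orient : ∀ {u v} → Adj G u v → O u v ⊎ O v u
    orient {u} e with c u in cu
    ... | true  = inj₁ (e , refl)
    ... | false = inj₂ (Graph.sym G e , trans (adjacent-colour proper e) (cong not cu))

    asymmetric : ∀ {u v} → O u v → ¬ O v u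
    asymmetric (e , cu) (_ , cv) = proper e (trans cu (sym cv))

    transitive : ∀ {a b c} → O a b → O b c → O a c
    transitive (e , ca) (_ , cb) =
      contradiction (trans (sym cb) (trans (adjacent-colour proper e) (cong not ca))) λ ()

∗-bipartite : ∀ {n n'} {G : Graph (Fin n)} {G' : Graph (Fin n')} (m : Fin n) (m' : Fin n') →
              Bipartite G → Bipartite G' → Bipartite (G ⟨ m ⟩∗⟨ m' ⟩ G')
∗-bipartite {G = G} {G'} m m' bipG bipG'
  with properColouring-with {G = G} bipG m false | properColouring-with {G = G'} bipG' m' true
... | c , proper , cm | c' , proper' , cm' = [ c ∘ proj₁ , c' ∘ proj₁ ] , λ {u v} → proper∗ {u} {v}
  where
  across : ∀ {a b} → Adj G m a → Adj G' m' b → c a ≢ c' b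
  across e e' ca≡c'b = contradiction
    (trans (sym (trans (adjacent-colour {G = G} proper e) (cong not cm)))
           (trans ca≡c'b (trans (adjacent-colour {G = G'} proper' e') (cong not cm'))))
    λ ()

  proper∗ : ProperColouring (G ⟨ m ⟩∗⟨ m' ⟩ G') [ c ∘ proj₁ , c' ∘ proj₁ ]
  proper∗ {inj₁ _} {inj₁ _} e        = proper e
  proper∗ {inj₂ _} {inj₂ _} e        = proper' e
  proper∗ {inj₁ _} {inj₂ _} (e , e') = across e e'
  proper∗ {inj₂ _} {inj₁ _} (e , e') = across e e' ∘ sym

corollary4 : ∀ {n n'} (G : Graph (Fin n)) (G' : Graph (Fin n'))
    → Connected G → Connected G' → Bipartite G → Bipartite G'
    → (m : Fin n) (m' : Fin n')
    → Comparability (G ⟨ m ⟩∗⟨ m' ⟩ G')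
corollary4 G G' _ _ bipG bipG' m m' =
  bipartite⇒comparability {G = G ⟨ m ⟩∗⟨ m' ⟩ G'} (∗-bipartite m m' bipG bipG')
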